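{- Let $X=2^\omega$ and let $\precsim$ be a total social welfare relation on $X$ satisfying Infinite Pareto and Anonymity. Then there exists a subset of $X$ which is not Mathias-Silver measurable.
   Context: For $x,y\in 2^\omega$ write $x\le y$ iff $x(n)\le y(n)$ for all $n$. A social welfare relation on $X$ is a reflexive and transitive relation $\precsim$; $x\sim y$ means $x\precsim y$ and $y\precsim x$; $x\prec y$ means $x\precsim y$ and not $y\precsim x$; it is total if any two elements are comparable. Anonymity: if $y$ is obtained from $x$ by swapping the values at two coordinates $i,j$ (i.e. $y(j)=x(i)$, $x(j)=y(i)$, $y(k)=x(k)$ for $k\ne i,j$), then $x\sim y$. Infinite Pareto: if $x\le y$ and $x(i)<y(i)$ for infinitely many $i$, then $x\prec y$. A tree is a set $T\subseteq 2^{<\omega}$ closed under initial segments; a node $t$ is splitting if $t^\frown0,t^\frown1\in T$; $T$ is perfect if every node has a splitting extension; $[p]=\{x\in2^\omega:\forall n\,(x\restriction n\in p)\}$. A Silver tree is a perfect tree $p$ such that for all $s,t\in p$ with $|s|=|t|$ and $i\in\{0,1\}$, $s^\frown i\in p\iff t^\frown i\in p$. For a Silver tree $p$, $S(p)$ is the set of numbers $|t|+1$ for $t$ a splitting node, $U(p):=\{n:\forall x\in[p]\,(x(n)=1)\}$, and $\{n^p_k:k\ge1\}$ increasingly enumerates $S(p)\cup U(p)$. A Mathias-Silver tree is a Silver tree $p$ with infinitely many triples $(n^p_{m_j},n^p_{m_j+1},n^p_{m_j+2})$ such that each $m_j$ is even, the three numbers lie in $S(p)$ with $n^p_{m_j}+1<n^p_{m_j+1}$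 and $n^p_{m_j+1}+1<n^p_{m_j+2}$, and for all $t\in p$ and $i<|t|$ with $n^p_{m_j}<i<n^p_{m_j+1}$ or $n^p_{m_j+1}<i<n^p_{m_j+2}$ we have $t(i)=0$. A set $Z\subseteq 2^\omega$ is Mathias-Silver measurable if there is a Mathias-Silver tree $p$ with $[p]\subseteq Z$ or $[p]\cap Z=\emptyset$. -}

module Defs where

open import Data.Bool using (Bool; true; false) renaming (_≤_ to _≤ᵇ_)
open import Data.Nat using (ℕ; zero; suc; _+_; _*_; _≤_; _<_)
open import Data.Fin using (Fin; toℕ; fromℕ<)
open import Data.List using (List; []; _∷_; _++_; [_]; length; take; tabulate; lookup)
open import Data.Product using (Σ; ∃; ∃-syntax; _×_; _,_)
open import Data.Sum using (_⊎_)
open import Data.Empty using (⊥)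
open import Relation.Nullary using (¬_)
open import Relation.Binary.PropositionalEquality using (_≡_; _≢_)

-- Cantor space 2^ω (coordinates indexed from 0)
Cantor : Set
Cantor = ℕ → Bool

Rel₂ : Set₁
Rel₂ = Cantor → Cantor → Set

_≤ω_ : Cantor → Cantor → Set
x ≤ω y = ∀ n → x n ≤ᵇ y n

module _ (_≾_ : Rel₂) where
  _∼_ : Rel₂
  x ∼ y = (x ≾ y) × (y ≾ x)

  _≺_ : Rel₂
  x ≺ y = (x ≾ y) × ¬ (y ≾ x)

  IsSocialWelfareRelation : Set
  IsSocialWelfareRelation =
    (∀ x → x ≾ x) × (∀ x y z → x ≾ y → y ≾ z → x ≾ z)

  IsTotal : Set
  IsTotal = ∀ x y → (x ≾ y) ⊎ (y ≾ x)

  Anonymity : Set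
  Anonymity = ∀ (x y : Cantor) (i j : ℕ) →
    y j ≡ x i → x j ≡ y i → (∀ k → k ≢ i → k ≢ j → y k ≡ x k) → x ∼ y

  InfinitePareto : Set
  InfinitePareto = ∀ (x y : Cantor) → x ≤ω y →
    (∀ N → ∃[ i ] (N ≤ i × x i ≡ false × y i ≡ true)) → x ≺ y

Seq : Set
Seq = List Bool

Tree : Set₁
Tree = Seq → Set

_↾_ : Cantor → ℕ → Seq
x ↾ n = tabulate {n = n} (λ i → x (toℕ i))

_⊑_ : Seq → Seq → Set
t ⊑ s = ∃[ u ] (s ≡ t ++ u)

IsTree : Tree → Set
IsTree T = ∀ t → T t → ∀ n → T (take n t)

Splitting : Tree → Seq → Set
Splitting T t = T (t ++ [ false ]) × T (t ++ [ true ])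

IsPerfect : Tree → Set
IsPerfect T = IsTree T × T [] ×
  (∀ t → T t → ∃[ s ] (t ⊑ s × T s × Splitting T s))

Body : Tree → Cantor → Set
Body p x = ∀ n → p (x ↾ n)

IsSilver : Tree → Set
IsSilver p = IsPerfect p ×
  (∀ s t → p s → p t → length s ≡ length t → ∀ i →
     (p (s ++ [ i ]) → p (t ++ [ i ])) × (p (t ++ [ i ]) → p (s ++ [ i ])))

-- S(p): (0-indexed) coordinates split at by some splitting node, i.e. lengths |t| of splitting nodes t
SSet : Tree → ℕ → Set
SSet p n = ∃[ t ] (p t × Splitting p t × length t ≡ n)

USet : Tree → ℕ → Set
USet p n = ∀ x → Body p x → x n ≡ true

SU : Tree → ℕ → Set
SU p n = SSet p n ⊎ USet p n

-- e is the strictly increasing enumeration of S(p) ∪ U(p); n^p_k = e (k - 1)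
Enumerates : Tree → (ℕ → ℕ) → Set
Enumerates p e = (∀ k → e k < e (suc k)) × (∀ k → SU p (e k)) × (∀ n → SU p n → ∃[ k ] (e k ≡ n))

ZeroBetween : Tree → ℕ → ℕ → Set
ZeroBetween p a b = ∀ t → p t → ∀ i → (i<|t| : i < length t) → a < i → i < b →
  lookup t (fromℕ< i<|t|) ≡ false

-- triple (n_m, n_{m+1}, n_{m+2}) with m = 2k+2 even (m ≥ 2), i.e. e(2k+1), e(2k+2), e(2k+3)
GoodTriple : Tree → (ℕ → ℕ) → ℕ → Set
GoodTriple p e k =
  let a = e (suc (2 * k)) ; b = e (suc (suc (2 * k))) ; c = e (suc (suc (suc (2 * k)))) in
  SSet p a × SSet p b × SSet p c × (suc a < b) × (suc b < c) ×
  ZeroBetween p a b × ZeroBetween p b c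

IsMathiasSilver : Tree → Set
IsMathiasSilver p = IsSilver p ×
  ∃[ e ] (Enumerates p e × (∀ N → ∃[ k ] (N ≤ k × GoodTriple p e k)))

MSMeasurable : (Cantor → Set) → Set₁
MSMeasurable Z = ∃[ p ] (IsMathiasSilver p ×
  ((∀ x → Body p x → Z x) ⊎ (∀ x → Body p x → Z x → ⊥)))

module Submission where

-- With P w the partial sums mod 2 of w and ū the complement of u, let Z be the set of
-- w with P w ≺ (P w)‾.  Given a Mathias-Silver tree p and a bit β we build branches
-- x, y of p whose partial sums are in β-pattern: (P x n, P y n) is eventually never
-- (¬β, ¬β) and infinitely often (β, β).  For β = true this makes (P x)‾ eventually
-- dominated by P y with infinitely many strict coordinates, so (P x)‾ ≺ P y by
-- Infinite Pareto (extended to eventual domination via Anonymity), and symmetrically;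
-- chaining the comparisons, x and y cannot both lie in Z.  For β = false the same
-- argument with totality shows x and y cannot both lie outside Z.

open import Defs
open import Data.Product using (∃; ∃-syntax; _×_; _,_; proj₁; proj₂)
open import Relation.Nullary using (¬_; yes; no; Dec)
open import Data.Bool using (Bool; true; false; not; _xor_; if_then_else_; b≤b) renaming (_≤_ to _≤ᵇ_)
open import Data.Nat using (ℕ; zero; suc; _+_; _*_; _≤_; _<_; z≤n; s≤s; _≟_)
open import Data.Nat.Properties
  using (≤-refl; ≤-trans; <-trans; ≤-reflexive; n≤1+n; m≤m+n; m≤n+m; m≤n⇒m⊓n≡m; +-comm; m≤n⇒m<n∨m≡n;
         ≤∧≢⇒<; <-cmp; <⇒≱; <-irrefl; *-suc; *-monoʳ-≤; module ≤-Reasoning)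
open import Data.Bool.Properties using (xor-assoc; xor-same; not-¬; ≤-minimum)
open import Data.Empty using (⊥; ⊥-elim)
open import Relation.Binary using (tri<; tri≈; tri>)
open import Data.Fin using (toℕ; fromℕ<)
open import Data.List using ([]; _∷_; _++_; [_]; length; take; lookup)
open import Data.List.Properties using (length-take; length-tabulate; length-++)
open import Data.Sum using (_⊎_; inj₁; inj₂)
open import Function using (_∘_)
open import Relation.Binary.PropositionalEquality hiding ([_])

↾-suc : ∀ (x : Cantor) n → x ↾ suc n ≡ x ↾ n ++ [ x n ]
↾-suc x zero = refl
↾-suc x (suc n) = cong (x 0 ∷_) (↾-suc (x ∘ suc) n)

length-↾ : ∀ (x : Cantor) n → length (x ↾ n) ≡ n
length-↾ x n = length-tabulate {n = n} (x ∘ toℕ)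

lookup-↾ : ∀ (x : Cantor) m n (n<m : n < length (x ↾ m)) → lookup (x ↾ m) (fromℕ< n<m) ≡ x n
lookup-↾ x (suc m) zero n<m = refl
lookup-↾ x (suc m) (suc n) (s≤s n<m) = lookup-↾ (x ∘ suc) m n n<m

take-suc : ∀ (t : Seq) m (m<|t| : m < length t) → take (suc m) t ≡ take m t ++ [ lookup t (fromℕ< m<|t|) ]
take-suc (a ∷ t) zero m<|t| = refl
take-suc (a ∷ t) (suc m) (s≤s m<|t|) = cong (a ∷_) (take-suc t m m<|t|)

-- By uniformity, whether a letter may follow a node depends
-- only on the node's length; hence the branches are exactly the sequences built from
-- letters available at each level, and a fixed branch may be changed freely at
-- splitting levels.
module SilverTree (p : Tree) (silver : IsSilver p) where
  private
    isTree : IsTree p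
    isTree = proj₁ (proj₁ silver)

    hasRoot : p []
    hasRoot = proj₁ (proj₂ (proj₁ silver))

    splitsAbove : ∀ t → p t → ∃[ s ] (t ⊑ s × p s × Splitting p s)
    splitsAbove = proj₂ (proj₂ (proj₁ silver))

    transfer : ∀ {s t} → p s → p t → length s ≡ length t → ∀ c → p (s ++ [ c ]) → p (t ++ [ c ])
    transfer {s} {t} ps pt |s|≡|t| c = proj₁ (proj₂ silver s t ps pt |s|≡|t| c)

  Available : ℕ → Bool → Set
  Available m c = ∃[ t ] (p t × length t ≡ m × p (t ++ [ c ]))

  body-from-available : ∀ y → (∀ m → Available m (y m)) → Body p y
  body-from-available y available zero = hasRoot
  body-from-available y available (suc m) with available m
  ... | t , pt , |t|≡m , ptc = subst p (sym (↾-suc y m))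
          (transfer pt (body-from-available y available m) |t|≡m′ (y m) ptc)
    where
    |t|≡m′ : length t ≡ length (y ↾ m)
    |t|≡m′ = trans |t|≡m (sym (length-↾ y m))

  split-available : ∀ {m} → SSet p m → ∀ c → Available m c
  split-available (t , pt , (pt0 , pt1) , |t|≡m) false = t , pt , |t|≡m , pt0
  split-available (t , pt , (pt0 , pt1) , |t|≡m) true = t , pt , |t|≡m , pt1

  -- a perfect tree has nodes of every length (take a child of a splitting extension)
  deepNode : ∀ n → ∃[ t ] (p t × n ≤ length t)
  deepNode zero = [] , hasRoot , z≤n
  deepNode (suc n) with deepNode n
  ... | t , pt , n≤|t| with splitsAbove t pt
  ... | s , (u , s≡t++u) , ps , ps0 , ps1 = s ++ [ false ] , ps0 , bound
    where
    open ≤-Reasoning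
    bound : suc n ≤ length (s ++ [ false ])
    bound = begin
      suc n                          ≤⟨ s≤s (≤-trans n≤|t| (m≤m+n (length t) (length u))) ⟩
      suc (length t + length u)      ≡⟨ cong suc (sym (length-++ t)) ⟩
      suc (length (t ++ u))          ≡⟨ cong (suc ∘ length) (sym s≡t++u) ⟩
      suc (length s)                 ≡⟨ +-comm 1 (length s) ⟩
      length s + 1                   ≡⟨ sym (length-++ s) ⟩
      length (s ++ [ false ])        ∎

  branch : Cantor
  branch n = lookup (proj₁ (deepNode (suc n))) (fromℕ< (proj₂ (proj₂ (deepNode (suc n)))))

  branch-available : ∀ m → Available m (branch m)
  branch-available m = take m t , isTree t pt m , |take| , subst p (take-suc t m m<|t|) (isTree t pt (suc m))
    where
    t : Seq
    t = proj₁ (deepNode (suc m))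
    pt : p t
    pt = proj₁ (proj₂ (deepNode (suc m)))
    m<|t| : m < length t
    m<|t| = proj₂ (proj₂ (deepNode (suc m)))
    |take| : length (take m t) ≡ m
    |take| = trans (length-take m t) (m≤n⇒m⊓n≡m (≤-trans (n≤1+n m) m<|t|))

  branch-body : Body p branch
  branch-body = body-from-available branch branch-available

  offSplitting-body : ∀ y → (∀ m → y m ≡ branch m ⊎ SSet p m) → Body p y
  offSplitting-body y agrees = body-from-available y available
    where
    available : ∀ m → Available m (y m)
    available m with agrees m
    ... | inj₁ ym≡ = subst (Available m) (sym ym≡) (branch-available m)
    ... | inj₂ split = split-available split (y m)

P : Cantor → Cantor
P w zero = w zero
P w (suc n) = P w n xor w (suc n)

Δ : Cantor → Cantor
Δ X zero = X zero
Δ X (suc n) = X n xor X (suc n)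

xor-cancelˡ : ∀ a c → a xor (a xor c) ≡ c
xor-cancelˡ a c = trans (sym (xor-assoc a a c)) (cong (_xor c) (xor-same a))

xor-shift : ∀ a c f → (a xor f) xor (c xor f) ≡ a xor c
xor-shift false false false = refl
xor-shift false false true = refl
xor-shift false true false = refl
xor-shift false true true = refl
xor-shift true false false = refl
xor-shift true false true = refl
xor-shift true true false = refl
xor-shift true true true = refl

xor-false≢true : ∀ a → a xor false ≢ a xor true
xor-false≢true false ()
xor-false≢true true ()

P-step : ∀ w n → P w n xor P w (suc n) ≡ w (suc n)
P-step w n = xor-cancelˡ (P w n) (w (suc n))

P-Δ : ∀ X n → P (Δ X) n ≡ X n
P-Δ X zero = refl
P-Δ X (suc n) = trans (cong (_xor Δ X (suc n)) (P-Δ X n)) (xor-cancelˡ (X n) (X (suc n)))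

module Increasing (r : ℕ → ℕ) (r-step : ∀ i → r i < r (suc i)) where

  r-mono : ∀ {i j} → i < j → r i < r j
  r-mono {i} {suc j} (s≤s i≤j) with m≤n⇒m<n∨m≡n i≤j
  ... | inj₁ i<j = <-trans (r-mono i<j) (r-step j)
  ... | inj₂ refl = r-step i

  r-grows : ∀ i → i ≤ r i
  r-grows zero = z≤n
  r-grows (suc i) = ≤-trans (s≤s (r-grows i)) (r-step i)

  -- count m = the number of indices i with r i < m
  count : ℕ → ℕ
  count zero = zero
  count (suc m) with m ≟ r (count m)
  ... | yes _ = suc (count m)
  ... | no _ = count m

  count-skip : ∀ m → m ≢ r (count m) → count (suc m) ≡ count m
  count-skip m m≢ with m ≟ r (count m)
  ... | yes m≡ = ⊥-elim (m≢ m≡)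
  ... | no _ = refl

  count-bounds : ∀ m → (∀ i → i < count m → r i < m) × m ≤ r (count m)
  count-bounds zero = (λ i ()) , z≤n
  count-bounds (suc m) with m ≟ r (count m) | count-bounds m
  ... | yes m≡ | below , _ = below′ , subst (λ k → suc k ≤ r (suc (count m))) (sym m≡) (r-step (count m))
    where
    below′ : ∀ i → i < suc (count m) → r i < suc m
    below′ i (s≤s i≤c) with m≤n⇒m<n∨m≡n i≤c
    ... | inj₁ i<c = ≤-trans (below i i<c) (n≤1+n m)
    ... | inj₂ refl = s≤s (≤-reflexive (sym m≡))
  ... | no m≢ | below , m≤ = (λ i i<c → ≤-trans (below i i<c) (n≤1+n m)) , ≤∧≢⇒< m≤ m≢

  count-point : ∀ i → count (r i) ≡ i
  count-point i with count-bounds (r i)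
  ... | below , ri≤ with <-cmp (count (r i)) i
  ... | tri< c<i _ _ = ⊥-elim (<⇒≱ (r-mono c<i) ri≤)
  ... | tri≈ _ c≡i _ = c≡i
  ... | tri> _ _ i<c = ⊥-elim (<-irrefl refl (below i i<c))

  count-after-point : ∀ i → count (suc (r i)) ≡ suc i
  count-after-point i with r i ≟ r (count (r i))
  ... | yes _ = cong suc (count-point i)
  ... | no ri≢ = ⊥-elim (ri≢ (cong r (sym (count-point i))))

  count-positive : ∀ m → r 0 < m → 0 < count m
  count-positive m r0<m with count m | count-bounds m
  ... | zero | _ , m≤r0 = ⊥-elim (<⇒≱ r0<m m≤r0)
  ... | suc _ | _ = s≤s z≤n

Pattern : Bool → Cantor → Cantor → Set
Pattern β u v = (∃[ N ] (∀ n → N ≤ n → ¬ (u n ≡ not β × v n ≡ not β)))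
              × (∀ M → ∃[ n ] (M ≤ n × u n ≡ β × v n ≡ β))

pattern-resp : ∀ {β u v u′ v′} → (∀ n → u n ≡ u′ n) → (∀ n → v n ≡ v′ n) →
  Pattern β u v → Pattern β u′ v′
pattern-resp u≗ v≗ ((N , late) , often) =
  (N , λ n N≤n (u′n , v′n) → late n N≤n (trans (u≗ n) u′n , trans (v≗ n) v′n)) ,
  λ M → let (n , M≤n , un , vn) = often M in n , M≤n , trans (sym (u≗ n)) un , trans (sym (v≗ n)) vn

pattern-sym : ∀ {β u v} → Pattern β u v → Pattern β v u
pattern-sym ((N , late) , often) =
  (N , λ n N≤n (vn , un) → late n N≤n (un , vn)) ,
  λ M → let (n , M≤n , un , vn) = often M in n , M≤n , vn , un

record GapSequence (p : Tree) (b : Cantor) : Set where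
  field
    point : ℕ → ℕ
    point-step : ∀ i → point i < point (suc i)
    point-splits : ∀ i → SSet p (point i)
    opens : ℕ → Bool
    opens-often : ∀ M → ∃[ i ] (M ≤ i × opens i ≡ true)
    gap : ∀ i → opens i ≡ true → ∀ n → point i < n → n < point (suc i) → b n ≡ false

-- The partial
-- sums are prescribed directly: on every opened gap both equal β; elsewhere both follow
-- the partial sums of the canonical branch, the second one flipped once the first level
-- is passed.  Their derivatives agree with the branch away from the levels of the gap
-- sequence (the gaps being where the branch is 0), so they are branches of p.
module Design (p : Tree) (silver : IsSilver p) (gs : GapSequence p (SilverTree.branch p silver))
  (β : Bool) where
  open SilverTree p silver
  open GapSequence gs
  open Increasing point point-step

  -- the prescribed value at n when exactly k levels lie at or below n; f is the flip
  segment : Bool → ℕ → ℕ → Bool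
  segment f zero n = P branch n
  segment f (suc i) n = if opens i then β else P branch n xor f

  design : Bool → Cantor
  design f n = segment f (count (suc n)) n

  segment-open : ∀ f i n → opens i ≡ true → segment f (suc i) n ≡ β
  segment-open f i n opens≡ rewrite opens≡ = refl

  segment-step : ∀ f k n → (∀ i → k ≡ suc i → opens i ≡ true → branch (suc n) ≡ false) →
    segment f k n xor segment f k (suc n) ≡ branch (suc n)
  segment-step f zero n _ = P-step branch n
  segment-step f (suc i) n inGap with opens i in opens≡
  ... | true = trans (xor-same β) (sym (inGap i refl opens≡))
  ... | false = trans (xor-shift (P branch n) (P branch (suc n)) f) (P-step branch n)

  design-Δ : ∀ f n → Δ (design f) n ≡ branch n ⊎ SSet p n
  design-Δ f n = byLevel n (n ≟ point (count n))
    where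
    byLevel : ∀ n → Dec (n ≡ point (count n)) → Δ (design f) n ≡ branch n ⊎ SSet p n
    byLevel n (yes n≡) = inj₂ (subst (SSet p) (sym n≡) (point-splits (count n)))
    byLevel zero (no 0≢) = inj₁ (cong (λ k → segment f k 0) (count-skip 0 0≢))
    byLevel (suc n) (no sn≢) =
      inj₁ (trans (cong (λ k → design f n xor segment f k (suc n)) (count-skip (suc n) sn≢))
                  (segment-step f (count (suc n)) n inGap))
      where
      inGap : ∀ i → count (suc n) ≡ suc i → opens i ≡ true → branch (suc n) ≡ false
      inGap i c≡ opens≡ = gap i opens≡ (suc n)
        (proj₁ (count-bounds (suc n)) i (subst (i <_) (sym c≡) ≤-refl))
        (subst (λ k → suc n < point k) c≡ (≤∧≢⇒< (proj₂ (count-bounds (suc n))) sn≢))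

  segment-late : ∀ k n → 0 < k → ¬ (segment false k n ≡ not β × segment true k n ≡ not β)
  segment-late (suc i) n _ with opens i
  ... | true = λ (β≡ , _) → not-¬ refl β≡
  ... | false = λ (X≡ , Y≡) → xor-false≢true (P branch n) (trans X≡ (sym Y≡))

  design-at-open : ∀ f i → opens i ≡ true → design f (point i) ≡ β
  design-at-open f i opens≡ = trans (cong (λ k → segment f k (point i)) (count-after-point i))
                                    (segment-open f i (point i) opens≡)

  design-pattern : Pattern β (design false) (design true)
  design-pattern =
    (point 0 , λ n p0≤n → segment-late (count (suc n)) n (count-positive (suc n) (s≤s p0≤n))) ,
    λ M → let (i , M≤i , opens≡) = opens-often M in
      point i , ≤-trans M≤i (r-grows i) , design-at-open false i opens≡ , design-at-open true i opens≡

  two-branches : ∃[ x ] ∃[ y ] (Body p x × Body p y × Pattern β (P x) (P y))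
  two-branches = Δ (design false) , Δ (design true) ,
    offSplitting-body _ (design-Δ false) , offSplitting-body _ (design-Δ true) ,
    pattern-resp (λ n → sym (P-Δ _ n)) (λ n → sym (P-Δ _ n)) design-pattern

interleave : {A : Set} → (ℕ → A) → (ℕ → A) → ℕ → A
interleave f g zero = f zero
interleave f g (suc zero) = g zero
interleave f g (suc (suc i)) = interleave (f ∘ suc) (g ∘ suc) i

interleave-all : ∀ {A : Set} (Q : A → Set) {f g : ℕ → A} →
  (∀ j → Q (f j)) → (∀ j → Q (g j)) → ∀ i → Q (interleave f g i)
interleave-all Q Qf Qg zero = Qf zero
interleave-all Q Qf Qg (suc zero) = Qg zero
interleave-all Q Qf Qg (suc (suc i)) = interleave-all Q (Qf ∘ suc) (Qg ∘ suc) i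

interleave-step : ∀ {f g : ℕ → ℕ} → (∀ j → f j < g j) → (∀ j → g j < f (suc j)) →
  ∀ i → interleave f g i < interleave f g (suc i)
interleave-step f<g g<f zero = f<g zero
interleave-step f<g g<f (suc zero) = g<f zero
interleave-step f<g g<f (suc (suc i)) = interleave-step (f<g ∘ suc) (g<f ∘ suc) i

marked : ℕ → Bool
marked = interleave (λ _ → true) (λ _ → false)

interleave-marked : ∀ {A : Set} (f g : ℕ → A) i → marked i ≡ true →
  ∃[ j ] (interleave f g i ≡ f j × interleave f g (suc i) ≡ g j)
interleave-marked f g zero _ = zero , refl , refl
interleave-marked f g (suc (suc i)) mi with interleave-marked (f ∘ suc) (g ∘ suc) i mi
... | j , fi≡ , gi≡ = suc j , fi≡ , gi≡

marked-often : ∀ M → ∃[ i ] (M ≤ i × marked i ≡ true)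
marked-often zero = zero , z≤n , refl
marked-often (suc M) with marked-often M
... | i , M≤i , mi = suc (suc i) , s≤s (≤-trans M≤i (n≤1+n i)) , mi

module Unbounded {Q : ℕ → Set} (often : ∀ N → ∃[ k ] (N ≤ k × Q k)) where
  select : ℕ → ℕ
  select zero = proj₁ (often zero)
  select (suc j) = proj₁ (often (suc (select j)))

  select-step : ∀ j → select j < select (suc j)
  select-step j = proj₁ (proj₂ (often (suc (select j))))

  select-holds : ∀ j → Q (select j)
  select-holds zero = proj₂ (proj₂ (often zero))
  select-holds (suc j) = proj₂ (proj₂ (often (suc (select j))))

-- A Mathias-Silver tree carries a gap sequence: choose infinitely many good triples
-- (in increasing order) and use the first two members (n_m, n_{m+1}) of each; the
-- branch is 0 strictly between them.
module MathiasSilver (p : Tree) (ms : IsMathiasSilver p) where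
  silver : IsSilver p
  silver = proj₁ ms

  open SilverTree p silver

  private
    e : ℕ → ℕ
    e = proj₁ (proj₂ ms)
    e-step : ∀ k → e k < e (suc k)
    e-step = proj₁ (proj₁ (proj₂ (proj₂ ms)))

    open Unbounded (proj₂ (proj₂ (proj₂ ms)))
    open Increasing e e-step using () renaming (r-mono to e-mono)

    -- the indices in e of the first two members of the j-th chosen triple
    first second : ℕ → ℕ
    first j = suc (2 * select j)
    second j = suc (suc (2 * select j))

    second<first : ∀ j → second j < first (suc j)
    second<first j = s≤s (≤-trans (≤-reflexive (sym (*-suc 2 (select j)))) (*-monoʳ-≤ 2 (select-step j)))

    level : ℕ → ℕ
    level = e ∘ interleave first second

    level-gap : ∀ i → marked i ≡ true → ∀ n → level i < n → n < level (suc i) → branch n ≡ false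
    level-gap i mi n lo hi with interleave-marked first second i mi
    ... | j , fi≡ , gi≡ with select-holds j
    ... | _ , _ , _ , _ , _ , zeros , _ =
      trans (sym (lookup-↾ branch (suc n) n n<|b↾|))
            (zeros (branch ↾ suc n) (branch-body (suc n)) n n<|b↾|
                   (subst (λ k → e k < n) fi≡ lo) (subst (λ k → n < e k) gi≡ hi))
      where
      n<|b↾| : n < length (branch ↾ suc n)
      n<|b↾| = subst (n <_) (sym (length-↾ branch (suc n))) ≤-refl

  gapSequence : GapSequence p branch
  gapSequence = record
    { point = level
    ; point-step = λ i → e-mono (interleave-step (λ j → ≤-refl) second<first i)
    ; point-splits = interleave-all (SSet p ∘ e) (λ j → proj₁ (select-holds j))
                                                 (λ j → proj₁ (proj₂ (select-holds j)))
    ; opens = marked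
    ; opens-often = marked-often
    ; gap = level-gap
    }

mathiasSilver-branches : ∀ p → IsMathiasSilver p → ∀ β →
  ∃[ x ] ∃[ y ] (Body p x × Body p y × Pattern β (P x) (P y))
mathiasSilver-branches p ms = Design.two-branches p silver gapSequence
  where open MathiasSilver p ms

extend-down : ∀ {Q : ℕ → Set} {N} → Q N → (∀ n → suc N ≤ n → Q n) → ∀ n → N ≤ n → Q n
extend-down QN Q> n N≤n with m≤n⇒m<n∨m≡n N≤n
... | inj₁ N<n = Q> n N<n
... | inj₂ refl = QN

≤ᵇ-or-violated : ∀ a c → a ≤ᵇ c ⊎ (a ≡ true × c ≡ false)
≤ᵇ-or-violated false c = inj₁ (≤-minimum c)
≤ᵇ-or-violated true true = inj₁ b≤b
≤ᵇ-or-violated true false = inj₂ (refl , refl)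

≤ᵇ-unless-violated : ∀ {a c} → ¬ (a ≡ true × c ≡ false) → a ≤ᵇ c
≤ᵇ-unless-violated {a} {c} notViolated with ≤ᵇ-or-violated a c
... | inj₁ a≤c = a≤c
... | inj₂ violated = ⊥-elim (notViolated violated)

not≡false⇒true : ∀ {a} → not a ≡ false → a ≡ true
not≡false⇒true {true} _ = refl

not≡true⇒false : ∀ {a} → not a ≡ true → a ≡ false
not≡true⇒false {false} _ = refl

InfinitelyOftenBelow : Cantor → Cantor → Set
InfinitelyOftenBelow u v = ∀ M → ∃[ i ] (M ≤ i × u i ≡ false × v i ≡ true)

complement : Cantor → Cantor
complement u n = not (u n)

swap : Cantor → ℕ → ℕ → Cantor
swap u a b k with k ≟ a | k ≟ b
... | yes _ | _ = u b
... | no _ | yes _ = u a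
... | no _ | no _ = u k

swap-at-first : ∀ u a b → swap u a b a ≡ u b
swap-at-first u a b with a ≟ a
... | yes _ = refl
... | no a≢a = ⊥-elim (a≢a refl)

swap-at-second : ∀ u a b → b ≢ a → swap u a b b ≡ u a
swap-at-second u a b b≢a with b ≟ a | b ≟ b
... | yes b≡a | _ = ⊥-elim (b≢a b≡a)
... | no _ | yes _ = refl
... | no _ | no b≢b = ⊥-elim (b≢b refl)

swap-elsewhere : ∀ u a b k → k ≢ a → k ≢ b → swap u a b k ≡ u k
swap-elsewhere u a b k k≢a k≢b with k ≟ a | k ≟ b
... | yes k≡a | _ = ⊥-elim (k≢a k≡a)
... | no _ | yes k≡b = ⊥-elim (k≢b k≡b)
... | no _ | no _ = refl

module Welfare (_≾_ : Rel₂) (swr : IsSocialWelfareRelation _≾_)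
  (pareto : InfinitePareto _≾_) (anon : Anonymity _≾_) where

  _≺′_ : Rel₂
  _≺′_ = _≺_ _≾_

  ≾-trans : ∀ {x y z} → x ≾ y → y ≾ z → x ≾ z
  ≾-trans = proj₂ swr _ _ _

  ≾-≺-trans : ∀ {x y z} → x ≾ y → y ≺′ z → x ≺′ z
  ≾-≺-trans x≾y (y≾z , z⋧y) = ≾-trans x≾y y≾z , λ z≾x → z⋧y (≾-trans z≾x x≾y)

  -- A coordinate N with u N > v N, followed by pointwise domination, is repaired by
  -- swapping it (anonymously) with a later coordinate where u is strictly below v.
  repair : ∀ N u v → u N ≡ true → v N ≡ false → (∀ n → suc N ≤ n → u n ≤ᵇ v n) →
    InfinitelyOftenBelow u v →
    ∃[ u′ ] (u ≾ u′ × (∀ n → N ≤ n → u′ n ≤ᵇ v n) × InfinitelyOftenBelow u′ v)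
  repair N u v uN vN dominated below with below (suc N)
  ... | i , N<i , ui , vi =
    swap u N i , u≾swapped , dominated′ , below′
    where
    i≢N : i ≢ N
    i≢N i≡N = <-irrefl (sym i≡N) N<i

    u≾swapped : u ≾ swap u N i
    u≾swapped = proj₁ (anon u (swap u N i) N i (swap-at-second u N i i≢N)
                         (sym (swap-at-first u N i)) (swap-elsewhere u N i))

    dominated′ : ∀ n → N ≤ n → swap u N i n ≤ᵇ v n
    dominated′ n N≤n = byCoordinate (n ≟ N) (n ≟ i)
      where
      byCoordinate : Dec (n ≡ N) → Dec (n ≡ i) → swap u N i n ≤ᵇ v n
      byCoordinate (yes refl) _ = subst (_≤ᵇ v n) (sym (trans (swap-at-first u N i) ui)) (≤-minimum (v n))
      byCoordinate (no _) (yes refl) = subst₂ _≤ᵇ_ (sym (trans (swap-at-second u N i i≢N) uN)) (sym vi) b≤b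
      byCoordinate (no n≢N) (no n≢i) = subst (_≤ᵇ v n) (sym (swap-elsewhere u N i n n≢N n≢i))
                                         (dominated n (≤∧≢⇒< N≤n (λ N≡n → n≢N (sym N≡n))))

    below′ : InfinitelyOftenBelow (swap u N i) v
    below′ M with below (suc (i + M))
    ... | j , i+M<j , uj , vj = j , ≤-trans (m≤n+m M i) (≤-trans (n≤1+n (i + M)) i+M<j) ,
                                trans (swap-elsewhere u N i j j≢N j≢i) uj , vj
      where
      i<j : i < j
      i<j = ≤-trans (s≤s (m≤m+n i M)) i+M<j
      j≢i : j ≢ i
      j≢i j≡i = <-irrefl (sym j≡i) i<j
      j≢N : j ≢ N
      j≢N j≡N = <-irrefl (sym j≡N) (<-trans N<i i<j)

  -- Infinite Pareto already applies when domination only holds from some N on: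
  -- the finitely many coordinates below N are repaired one by one.
  eventual-pareto : ∀ N u v → (∀ n → N ≤ n → u n ≤ᵇ v n) → InfinitelyOftenBelow u v → u ≺′ v
  eventual-pareto zero u v dominated below = pareto u v (λ n → dominated n z≤n) below
  eventual-pareto (suc N) u v dominated below with ≤ᵇ-or-violated (u N) (v N)
  ... | inj₁ uN≤vN = eventual-pareto N u v (extend-down uN≤vN dominated) below
  ... | inj₂ (uN , vN) with repair N u v uN vN dominated below
  ... | u′ , u≾u′ , dominated′ , below′ = ≾-≺-trans u≾u′ (eventual-pareto N u′ v dominated′ below′)

  pattern-true-below : ∀ {u v} → Pattern true u v → complement u ≺′ v
  pattern-true-below ((N , late) , often) =
    eventual-pareto N _ _
      (λ n N≤n → ≤ᵇ-unless-violated (λ (ūn , vn) → late n N≤n (not≡true⇒false ūn , vn)))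
      (λ M → let (n , M≤n , un , vn) = often M in n , M≤n , cong not un , vn)

  pattern-false-below : ∀ {u v} → Pattern false u v → u ≺′ complement v
  pattern-false-below ((N , late) , often) =
    eventual-pareto N _ _
      (λ n N≤n → ≤ᵇ-unless-violated (λ (un , v̄n) → late n N≤n (un , not≡false⇒true v̄n)))
      (λ M → let (n , M≤n , un , vn) = often M in n , M≤n , un , cong not vn)

  -- In true-pattern, u and v cannot both be strictly below their complements:
  -- ū ≾ v ≾ v̄ ≾ u would contradict u ≺ ū.
  not-both-below : ∀ {u v} → Pattern true u v →
    u ≺′ complement u → v ≺′ complement v → ⊥
  not-both-below pat (_ , ū⋧u) (v≾v̄ , _) =
    ū⋧u (≾-trans (proj₁ (pattern-true-below pat))
           (≾-trans v≾v̄ (proj₁ (pattern-true-below (pattern-sym pat)))))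

  above-complement : IsTotal _≾_ → ∀ u → ¬ (u ≺′ complement u) → ¬ ¬ (complement u ≾ u)
  above-complement total u notBelow ū⋧u with total u (complement u)
  ... | inj₁ u≾ū = notBelow (u≾ū , ū⋧u)
  ... | inj₂ ū≾u = ū⋧u ū≾u

  -- In false-pattern, u and v cannot both fail to be strictly below their complements:
  -- v̄ ≾ v ≾ ū ≾ u would contradict u ≺ v̄.
  not-both-not-below : IsTotal _≾_ → ∀ {u v} → Pattern false u v →
    ¬ (u ≺′ complement u) → ¬ (v ≺′ complement v) → ⊥
  not-both-not-below total {u} {v} pat u⊀ū v⊀v̄ =
    above-complement total u u⊀ū λ ū≾u →
    above-complement total v v⊀v̄ λ v̄≾v →
    proj₂ (pattern-false-below pat)
      (≾-trans v̄≾v (≾-trans (proj₁ (pattern-false-below (pattern-sym pat))) ū≾u))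

mainTheorem4 : (_≾_ : Rel₂) → IsSocialWelfareRelation _≾_ → IsTotal _≾_ →
    InfinitePareto _≾_ → Anonymity _≾_ →
    ∃[ Z ] (¬ MSMeasurable Z)
mainTheorem4 _≾_ swr total pareto anon = Z , notMeasurable
  where
  open Welfare _≾_ swr pareto anon

  Z : Cantor → Set
  Z w = P w ≺′ complement (P w)

  notMeasurable : ¬ MSMeasurable Z
  notMeasurable (p , ms , inj₁ insideZ) =
    let (x , y , x∈p , y∈p , pat) = mathiasSilver-branches p ms true in
    not-both-below pat (insideZ x x∈p) (insideZ y y∈p)
  notMeasurable (p , ms , inj₂ outsideZ) =
    let (x , y , x∈p , y∈p , pat) = mathiasSilver-branches p ms false in
    not-both-not-below total pat (outsideZ x x∈p) (outsideZ y y∈p)
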